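{- Let $a$ and $b$ be coprime positive integers. Then $a^2+b^2+ab$ and $a(a+b)$ are not both perfect squares. -}

module Defs where

open import Data.Nat using (ℕ; _*_)
open import Data.Product using (∃)
open import Relation.Binary.PropositionalEquality using (_≡_)

IsSquare : ℕ → Set
IsSquare n = ∃ λ m → m * m ≡ n

{-# OPTIONS --safe #-}
-- Since a and a + b are coprime with a square product, a = s² and a + b = t²; then
-- a² + ab + b² = (st)² + b², so (st, b, c) is a primitive Pythagorean triple with t² − s² = b,
-- that is t⁴ − t²s² + s⁴ = c².  Such solutions are excluded by descent on c:
--  * if b is even (s and t odd), the parametrisation b = 2mn, st = m² − n² gives the solution
--    (n, m, st) with c′ = s² + b/2 < c;
--  * if st is even, say {s, t} = {2x, u}, the parametrisation st = 2mn, b = m² − n² and the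
--    four-number lemma applied to xu = mn lead to q² + r² = p² and (2q)² + r² = w² (the two
--    sums of squares are coprime since their common divisors divide 3, and 3 ∤ q² + r²);
--    parametrising the second triple as q = αβ, r = α² − β² gives the solution (β, α, r)
--    with c′ = p < c.
module Submission where

open import Defs
open import Data.Nat using (ℕ; _+_; _*_; _^_; _<_)
open import Data.Nat.Coprimality using (Coprime)
open import Data.Product using (_×_)
open import Relation.Nullary using (¬_)

open import Data.List.Base using ([]; _∷_)
open import Data.Nat using (suc; _≤_; _%_; z<s; s<s; NonZero; >-nonZero; parity)
open import Data.Nat.Coprimality using (coprime-divisor; coprime-factors; coprime-+; GCD≡1⇒coprime)
import Data.Nat.Coprimality as Coprime
open import Data.Nat.Divisibility
open import Data.Nat.DivMod using (%-distribˡ-+; %-distribˡ-*; m%n<n)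
open import Data.Nat.GCD
  using (gcd; gcd[m,n]∣m; gcd[m,n]∣n; gcd-greatest; c*gcd[m,n]≡gcd[cm,cn]; mkGCD; GCD; module GCD; GCD-*)
open import Data.Nat.Induction using (<-rec)
open import Data.Nat.Primality using (Prime; prime?; prime[2]; prime⇒irreducible; euclidsLemma)
open import Data.Nat.Properties
open import Algebra.Properties.CommutativeSemigroup *-commutativeSemigroup using (xy∙z≈xz∙y; x∙yz≈y∙xz)
open import Data.Nat.Tactic.RingSolver using (solve)
open import Data.Parity.Base as ℙ using (0ℙ; 1ℙ)
open import Data.Parity.Properties using (+-homo-+; *-homo-*; +-0-group)
open import Algebra.Properties.Group +-0-group using (identityʳ-unique)
open import Data.Product using (∃-syntax; _,_)
open import Data.Sum using (inj₁; inj₂; [_,_]′)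
open import Function using (_∘_; id; case_of_)
open import Relation.Nullary using (contradiction)
open import Relation.Nullary.Decidable using (from-yes)
open import Relation.Binary.PropositionalEquality
  using (_≡_; refl; sym; trans; cong; cong₂; subst; module ≡-Reasoning)

square-cancel-≤ : ∀ {m n} → m * m ≤ n * n → m ≤ n
square-cancel-≤ m²≤n² = ≮⇒≥ λ n<m → <⇒≱ (*-mono-< n<m n<m) m²≤n²

square-cancel-< : ∀ {m n} → m * m < n * n → m < n
square-cancel-< m²<n² = ≰⇒> λ n≤m → <⇒≱ m²<n² (*-mono-≤ n≤m n≤m)

square-injective : ∀ {m n} → m * m ≡ n * n → m ≡ n
square-injective eq =
  ≤-antisym (square-cancel-≤ (≤-reflexive eq)) (square-cancel-≤ (≤-reflexive (sym eq)))

m*n>0⇒m>0 : ∀ m {n} → 0 < m * n → 0 < m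
m*n>0⇒m>0 (suc _) _ = z<s

m*n>0⇒n>0 : ∀ m {n} → 0 < m * n → 0 < n
m*n>0⇒n>0 m {n} = m*n>0⇒m>0 n ∘ subst (0 <_) (*-comm m n)

coprime-∣ˡ : ∀ {m n d} → d ∣ m → Coprime m n → Coprime d n
coprime-∣ˡ d∣m m⊥n (i∣d , i∣n) = m⊥n (∣-trans i∣d d∣m , i∣n)

coprime-∣ʳ : ∀ {m n d} → d ∣ n → Coprime m n → Coprime m d
coprime-∣ʳ d∣n = Coprime.sym ∘ coprime-∣ˡ d∣n ∘ Coprime.sym

coprime-*ˡ : ∀ {m n o} → Coprime m o → Coprime n o → Coprime (m * n) o
coprime-*ˡ m⊥o n⊥o (i∣mn , i∣o) =
  n⊥o (coprime-divisor (coprime-∣ˡ i∣o (Coprime.sym m⊥o)) i∣mn , i∣o)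

coprime-*ʳ : ∀ {m n o} → Coprime m n → Coprime m o → Coprime m (n * o)
coprime-*ʳ m⊥n m⊥o = Coprime.sym (coprime-*ˡ (Coprime.sym m⊥n) (Coprime.sym m⊥o))

coprime-square : ∀ {m n} → Coprime m n → Coprime (m * m) (n * n)
coprime-square {m} {n} m⊥n = coprime-*ˡ m⊥n² m⊥n²
  where
  m⊥n² : Coprime m (n * n)
  m⊥n² = coprime-*ʳ m⊥n m⊥n

coprime-square⇒coprime : ∀ {m n} → Coprime (m * m) (n * n) → Coprime m n
coprime-square⇒coprime m²⊥n² = coprime-∣ˡ (m∣m*n _) (coprime-∣ʳ (m∣m*n _) m²⊥n²)

coprime-+ʳ : ∀ {m n} → Coprime m n → Coprime m (m + n)
coprime-+ʳ m⊥n = Coprime.sym (coprime-+ (Coprime.sym m⊥n))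

prime∤⇒coprime : ∀ {p n} → Prime p → p ∤ n → Coprime p n
prime∤⇒coprime p-prime p∤n (d∣p , d∣n) with prime⇒irreducible p-prime d∣p
... | inj₁ d≡1  = d≡1
... | inj₂ refl = contradiction d∣n p∤n

prime[3] : Prime 3
prime[3] = from-yes (prime? 3)

coprime-cross-multiplication : ∀ {x w a b} → Coprime x w → Coprime a b → x * a ≡ w * b → a ≡ w
coprime-cross-multiplication {x} {w} {a} {b} x⊥w a⊥b xa≡wb = ∣-antisym a∣w w∣a
  where
  a∣w : a ∣ w
  a∣w = coprime-divisor a⊥b (divides x (trans (*-comm b w) (sym xa≡wb)))
  w∣a : w ∣ a
  w∣a = coprime-divisor (Coprime.sym x⊥w) (divides b (trans xa≡wb (*-comm w b)))

-- The root is gcd u w: its square divides u (being coprime to v) and u divides its square.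
coprime-*≡square⇒squareˡ : ∀ {u v w} → Coprime u v → u * v ≡ w * w → IsSquare u
coprime-*≡square⇒squareˡ {u} {v} {w} u⊥v uv≡w² = g , ∣-antisym g²∣u u∣g²
  where
  g : ℕ
  g = gcd u w
  g⊥v : Coprime g v
  g⊥v = coprime-∣ˡ (gcd[m,n]∣m u w) u⊥v
  g²∣u : g * g ∣ u
  g²∣u = coprime-divisor (coprime-*ˡ g⊥v g⊥v)
    (subst (g * g ∣_) (trans (sym uv≡w²) (*-comm u v)) (*-pres-∣ (gcd[m,n]∣n u w) (gcd[m,n]∣n u w)))
  u∣wg : u ∣ w * g
  u∣wg = subst (u ∣_) (sym (c*gcd[m,n]≡gcd[cm,cn] w u w))
    (gcd-greatest (n∣m*n w) (subst (u ∣_) uv≡w² (m∣m*n v)))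
  u∣g² : u ∣ g * g
  u∣g² = subst (u ∣_) (sym (c*gcd[m,n]≡gcd[cm,cn] g u w))
    (gcd-greatest (n∣m*n g) (subst (u ∣_) (*-comm w g) u∣wg))

coprime-*≡square⇒squares : ∀ {u v w} → Coprime u v → u * v ≡ w * w → IsSquare u × IsSquare v
coprime-*≡square⇒squares {u} {v} {w} u⊥v uv≡w² =
  coprime-*≡square⇒squareˡ {u} {v} {w} u⊥v uv≡w² ,
  coprime-*≡square⇒squareˡ {v} {u} {w} (Coprime.sym u⊥v) (trans (*-comm v u) uv≡w²)

four-number-lemma : ∀ {a b c d} → 0 < a → a * b ≡ c * d →
  ∃[ p ] ∃[ q ] ∃[ r ] ∃[ w ] a ≡ p * q × b ≡ r * w × c ≡ p * r × d ≡ q * w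
four-number-lemma {a} {b} {c} {d} a>0 ab≡cd with mkGCD a c
... | g , gcd[a,c]≡g with GCD.commonDivisor gcd[a,c]≡g
... | divides q refl , divides r refl = g , q , r , w , *-comm q g , b≡rw , *-comm r g , d≡qw
  where
  instance
    g≢0 : NonZero g
    g≢0 = >-nonZero (m*n>0⇒n>0 q a>0)
    q≢0 : NonZero q
    q≢0 = >-nonZero (m*n>0⇒m>0 q a>0)
  q⊥r : Coprime q r
  q⊥r = GCD≡1⇒coprime (GCD-* (subst (GCD _ _) (sym (*-identityˡ g)) gcd[a,c]≡g))
  qb≡rd : q * b ≡ r * d
  qb≡rd = *-cancelʳ-≡ _ _ g (trans (xy∙z≈xz∙y q b g) (trans ab≡cd (xy∙z≈xz∙y r g d)))
  q∣d : q ∣ d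
  q∣d = coprime-divisor q⊥r (divides b (trans (sym qb≡rd) (*-comm q b)))
  w : ℕ
  w = quotient q∣d
  d≡qw : d ≡ q * w
  d≡qw = m∣n⇒n≡m*quotient q∣d
  b≡rw : b ≡ r * w
  b≡rw = *-cancelˡ-≡ b (r * w) q (trans qb≡rd (trans (cong (r *_) d≡qw) (x∙yz≈y∙xz r q w)))

parity≡0ℙ⇒even : ∀ n → parity n ≡ 0ℙ → ∃[ k ] n ≡ 2 * k
parity≡0ℙ⇒even 0             _      = 0 , refl
parity≡0ℙ⇒even (suc (suc n)) n-even with k , refl ← parity≡0ℙ⇒even n n-even =
  suc k , sym (*-suc 2 k)

odd-square-gap-even : ∀ {s t d} → parity s ≡ 1ℙ → parity t ≡ 1ℙ → s * s + d ≡ t * t →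
  ∃[ k ] d ≡ 2 * k
odd-square-gap-even {s} {t} {d} s-odd t-odd gap =
  parity≡0ℙ⇒even d (identityʳ-unique 1ℙ (parity d) (begin
    1ℙ ℙ.+ parity d                     ≡⟨ cong (λ p → p ℙ.* p ℙ.+ parity d) s-odd ⟨
    parity s ℙ.* parity s ℙ.+ parity d  ≡⟨ cong (ℙ._+ parity d) (*-homo-* s s) ⟨
    parity (s * s) ℙ.+ parity d         ≡⟨ +-homo-+ (s * s) d ⟨
    parity (s * s + d)                  ≡⟨ cong parity gap ⟩
    parity (t * t)                      ≡⟨ *-homo-* t t ⟩
    parity t ℙ.* parity t               ≡⟨ cong (λ p → p ℙ.* p) t-odd ⟩
    1ℙ                                  ∎))
  where open ≡-Reasoning

sum-of-squares-residues : ∀ {i j} → i < 3 → j < 3 → (i * i + j * j) % 3 ≡ 0 → i ≡ 0 × j ≡ 0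
sum-of-squares-residues {0} {0} _ _ _  = refl , refl
sum-of-squares-residues {0} {1} _ _ ()
sum-of-squares-residues {0} {2} _ _ ()
sum-of-squares-residues {1} {0} _ _ ()
sum-of-squares-residues {1} {1} _ _ ()
sum-of-squares-residues {1} {2} _ _ ()
sum-of-squares-residues {2} {0} _ _ ()
sum-of-squares-residues {2} {1} _ _ ()
sum-of-squares-residues {2} {2} _ _ ()
sum-of-squares-residues {suc (suc (suc _))} (s<s (s<s (s<s ()))) _ _
sum-of-squares-residues {_} {suc (suc (suc _))} _ (s<s (s<s (s<s ()))) _

3∣sum-of-squares⇒3∣ : ∀ y z → 3 ∣ y * y + z * z → 3 ∣ y × 3 ∣ z
3∣sum-of-squares⇒3∣ y z 3∣y²+z² with sum-of-squares-residues (m%n<n y 3) (m%n<n z 3) residues≡0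
  where
  open ≡-Reasoning
  residues≡0 : (y % 3 * (y % 3) + z % 3 * (z % 3)) % 3 ≡ 0
  residues≡0 = begin
    (y % 3 * (y % 3) + z % 3 * (z % 3)) % 3
      ≡⟨ %-distribˡ-+ (y % 3 * (y % 3)) _ 3 ⟩
    ((y % 3 * (y % 3)) % 3 + (z % 3 * (z % 3)) % 3) % 3
      ≡⟨ cong₂ (λ m n → (m + n) % 3) (%-distribˡ-* y y 3) (%-distribˡ-* z z 3) ⟨
    ((y * y) % 3 + (z * z) % 3) % 3
      ≡⟨ %-distribˡ-+ (y * y) (z * z) 3 ⟨
    (y * y + z * z) % 3
      ≡⟨ n∣m⇒m%n≡0 _ 3 3∣y²+z² ⟩
    0 ∎
... | y%3≡0 , z%3≡0 = m%n≡0⇒n∣m y 3 y%3≡0 , m%n≡0⇒n∣m z 3 z%3≡0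

coprime-sums-of-squares : ∀ {y z} → Coprime y z →
  Coprime ((2 * y) * (2 * y) + z * z) (y * y + z * z)
coprime-sums-of-squares {y} {z} y⊥z {i} (i∣A , i∣B) = 3⊥B (i∣3 , i∣B)
  where
  3⊥B : Coprime 3 (y * y + z * z)
  3⊥B = prime∤⇒coprime prime[3] λ 3∣B →
    contradiction (y⊥z (3∣sum-of-squares⇒3∣ y z 3∣B)) λ ()
  A≡B+3y² : (2 * y) * (2 * y) + z * z ≡ (y * y + z * z) + y * y * 3
  A≡B+3y² = solve (y ∷ z ∷ [])
  4B≡A+3z² : 4 * (y * y + z * z) ≡ ((2 * y) * (2 * y) + z * z) + z * z * 3
  4B≡A+3z² = solve (y ∷ z ∷ [])
  i∣3 : i ∣ 3
  i∣3 = coprime-factors (coprime-square y⊥z)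
    ( ∣m+n∣m⇒∣n (subst (i ∣_) A≡B+3y² i∣A) i∣B
    , ∣m+n∣m⇒∣n (subst (i ∣_) 4B≡A+3z² (∣n⇒∣m*n 4 i∣B)) i∣A )

sums-of-squares-squares : ∀ {x w y z} → Coprime x w → Coprime y z →
  x * x * ((2 * y) * (2 * y) + z * z) ≡ w * w * (y * y + z * z) →
  y * y + z * z ≡ x * x × (2 * y) * (2 * y) + z * z ≡ w * w
sums-of-squares-squares x⊥w y⊥z cross =
  coprime-cross-multiplication (Coprime.sym (coprime-square x⊥w)) (Coprime.sym (coprime-sums-of-squares y⊥z))
    (sym cross) ,
  coprime-cross-multiplication (coprime-square x⊥w) (coprime-sums-of-squares y⊥z) cross

hypotenuse-excess-even : ∀ {a e δ} → a * a + (2 * e) * (2 * e) ≡ (a + δ) * (a + δ) → 2 ∣ δ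
hypotenuse-excess-even {a} {e} {δ} pyth =
  [ id , (λ 2∣2a+δ → ∣m+n∣m⇒∣n 2∣2a+δ (m∣m*n a)) ]′
    (euclidsLemma δ (2 * a + δ) prime[2] 2∣excess)
  where
  excess : δ * (2 * a + δ) ≡ (2 * e) * (2 * e)
  excess = +-cancelˡ-≡ (a * a) _ _ (begin
    a * a + δ * (2 * a + δ)      ≡⟨ solve (a ∷ δ ∷ []) ⟩
    (a + δ) * (a + δ)            ≡⟨ pyth ⟨
    a * a + (2 * e) * (2 * e)    ∎)
    where open ≡-Reasoning
  2∣excess : 2 ∣ δ * (2 * a + δ)
  2∣excess = subst (2 ∣_) (sym excess) (∣m⇒∣m*n (2 * e) (m∣m*n e))

pythagorean-halves : ∀ {a e c} → Coprime a (2 * e) → a * a + (2 * e) * (2 * e) ≡ c * c →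
  ∃[ u ] a + u + u ≡ c × u * (a + u) ≡ e * e × Coprime u (a + u)
pythagorean-halves {a} {e} {c} a⊥2e pyth
  with δ , refl ← m≤n⇒∃[o]m+o≡n {a} {c}
                    (square-cancel-≤ (subst (a * a ≤_) pyth (m≤m+n (a * a) _)))
  with divides u refl ← hypotenuse-excess-even {a} {e} {δ} pyth
  = u , solve (a ∷ u ∷ []) , u[a+u]≡e² , u⊥a+u
  where
  u[a+u]≡e² : u * (a + u) ≡ e * e
  u[a+u]≡e² = *-cancelˡ-≡ _ _ 4 (+-cancelˡ-≡ (a * a) _ _ (begin
    a * a + 4 * (u * (a + u))    ≡⟨ solve (a ∷ u ∷ []) ⟩
    (a + u * 2) * (a + u * 2)    ≡⟨ pyth ⟨
    a * a + (2 * e) * (2 * e)    ≡⟨ solve (a ∷ e ∷ []) ⟩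
    a * a + 4 * (e * e)          ∎))
    where open ≡-Reasoning
  a⊥e : Coprime a e
  a⊥e = coprime-∣ʳ (n∣m*n 2) a⊥2e
  u⊥a+u : Coprime u (a + u)
  u⊥a+u {i} (i∣u , i∣a+u) = coprime-*ʳ a⊥e a⊥e
    ( ∣m+n∣m⇒∣n (subst (i ∣_) (+-comm a u) i∣a+u) i∣u
    , subst (i ∣_) u[a+u]≡e² (∣m⇒∣m*n (a + u) i∣u) )

primitive-pythagorean-triple : ∀ {a b c e} → Coprime a b → a * a + b * b ≡ c * c → b ≡ 2 * e →
  ∃[ m ] ∃[ n ] c ≡ m * m + n * n × n * n + a ≡ m * m × e ≡ m * n × Coprime m n
primitive-pythagorean-triple {a} {c = c} {e} a⊥b pyth refl
  with pythagorean-halves {a} {e} {c} a⊥b pyth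
... | u , a+u+u≡c , u[a+u]≡e² , u⊥a+u
  with (n , refl) , (m , m²≡a+n²) ← coprime-*≡square⇒squares {u} {a + u} {e} u⊥a+u u[a+u]≡e²
  = m , n
  , trans (sym a+u+u≡c) (cong (_+ n * n) (sym m²≡a+n²))
  , trans (+-comm (n * n) a) (sym m²≡a+n²)
  , e≡mn
  , Coprime.sym (coprime-square⇒coprime (subst (Coprime (n * n)) (sym m²≡a+n²) u⊥a+u))
  where
  e≡mn : e ≡ m * n
  e≡mn = square-injective (begin
    e * e                  ≡⟨ u[a+u]≡e² ⟨
    n * n * (a + n * n)    ≡⟨ cong (n * n *_) m²≡a+n² ⟨
    n * n * (m * m)        ≡⟨ solve (m ∷ n ∷ []) ⟩
    (m * n) * (m * n)      ∎)
    where open ≡-Reasoning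

common-gap : ∀ {a b c e d} → a + d ≡ b → c + d ≡ e → a + e ≡ b + c
common-gap {a} {c = c} {d = d} refl refl = trans (cong (a +_) (+-comm c d)) (sym (+-assoc a d c))

square-gap⇒t>0 : ∀ {s t d} → 0 < d → s * s + d ≡ t * t → 0 < t
square-gap⇒t>0 {s} {t} {d} d>0 gap = m*n>0⇒m>0 t (subst (0 <_) gap (≤-trans d>0 (m≤n+m d (s * s))))

coprime-square-gap : ∀ {s t d} → Coprime s t → s * s + d ≡ t * t → Coprime (s * t) d
coprime-square-gap {s} {t} {d} s⊥t gap = coprime-*ˡ s⊥d t⊥d
  where
  s⊥d : Coprime s d
  s⊥d {i} (i∣s , i∣d) = s⊥t (i∣s , coprime-divisor (coprime-∣ˡ i∣s s⊥t)
    (subst (i ∣_) gap (∣m∣n⇒∣m+n (∣m⇒∣m*n s i∣s) i∣d)))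
  t⊥d : Coprime t d
  t⊥d {i} (i∣t , i∣d) = s⊥t (coprime-divisor (coprime-∣ˡ i∣t (Coprime.sym s⊥t))
    (∣m+n∣m⇒∣n (subst (i ∣_) (trans (sym gap) (+-comm (s * s) d)) (∣m⇒∣m*n t i∣t)) i∣d)
    , i∣t)

even-product-triple : ∀ {s t d c k} → Coprime s t → s * s + d ≡ t * t →
  (s * t) * (s * t) + d * d ≡ c * c → s * t ≡ 2 * k →
  ∃[ m ] ∃[ n ] c ≡ m * m + n * n × n * n + d ≡ m * m × k ≡ m * n × Coprime m n
even-product-triple {s} {t} {d} {c} {k} s⊥t gap pyth = primitive-pythagorean-triple {d} {s * t} {c} {k}
  (Coprime.sym (coprime-square-gap s⊥t gap)) (trans (+-comm (d * d) _) pyth)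

-- d stands for t² − s², so that no truncated subtraction is needed.
record Solution (c : ℕ) : Set where
  constructor solution
  field
    s t d       : ℕ
    s>0         : 0 < s
    d>0         : 0 < d
    square-gap  : s * s + d ≡ t * t
    s⊥t         : Coprime s t
    pythagorean : (s * t) * (s * t) + d * d ≡ c * c

two-triangles⇒solution : ∀ {x w y z} → 0 < y → 0 < z → 2 ∤ z → Coprime y z →
  y * y + z * z ≡ x * x × (2 * y) * (2 * y) + z * z ≡ w * w → Solution x
two-triangles⇒solution {x} {w} {y} {z} y>0 z>0 2∤z y⊥z (y²+z²≡x² , [2y]²+z²≡w²) =
  case primitive-pythagorean-triple {z} {2 * y} {w} {y} z⊥2y (trans (+-comm (z * z) _) [2y]²+z²≡w²) refl
  of λ where
    (α , β , _ , β²+z≡α² , y≡αβ , α⊥β) →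
      solution β α z (m*n>0⇒n>0 α (subst (0 <_) y≡αβ y>0)) z>0 β²+z≡α² (Coprime.sym α⊥β)
        (trans (cong (λ k → k * k + z * z) (trans (*-comm β α) (sym y≡αβ))) y²+z²≡x²)
  where
  z⊥2y : Coprime z (2 * y)
  z⊥2y = coprime-*ʳ (Coprime.sym (prime∤⇒coprime prime[2] 2∤z)) (Coprime.sym y⊥z)

-- {2x, u} = {s, t}, and (y, v) are the parameters (m, n) of the triple (d, st, c),
-- in the order matching (2x, u).
descent-from-even-leg : ∀ {c x u y v} → 0 < x → 0 < u → Coprime (2 * x) u → Coprime y v →
  x * u ≡ y * v → (2 * x) * (2 * x) + y * y ≡ u * u + v * v → c ≡ y * y + v * v →
  ∃[ c′ ] c′ < c × Solution c′
descent-from-even-leg {c} {x} {u} {y} {v} x>0 u>0 2x⊥u y⊥v xu≡yv squares refl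
  with p , q , r , w , refl , refl , refl , refl ← four-number-lemma {x} {u} {y} {v} x>0 xu≡yv
  = p , p<c , two-triangles⇒solution {p} {w} q>0 r>0 2∤r q⊥r (sums-of-squares-squares p⊥w q⊥r cross)
  where
  q>0 : 0 < q
  q>0 = m*n>0⇒n>0 p x>0
  r>0 : 0 < r
  r>0 = m*n>0⇒m>0 r u>0
  qw>0 : 0 < q * w
  qw>0 = *-mono-< q>0 (m*n>0⇒n>0 r u>0)
  instance
    r≢0 : NonZero r
    r≢0 = >-nonZero r>0
    pr≢0 : NonZero (p * r)
    pr≢0 = >-nonZero (*-mono-< (m*n>0⇒m>0 p x>0) r>0)
  p<c : p < (p * r) * (p * r) + (q * w) * (q * w)
  p<c = begin-strict
    p                                       ≤⟨ m≤m*n p r ⟩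
    p * r                                   ≤⟨ m≤m*n (p * r) (p * r) ⟩
    (p * r) * (p * r)                       <⟨ m<m+n _ (*-mono-< qw>0 qw>0) ⟩
    (p * r) * (p * r) + (q * w) * (q * w)   ∎
    where open ≤-Reasoning
  2∤r : 2 ∤ r
  2∤r 2∣r = contradiction (2x⊥u (m∣m*n (p * q) , ∣-trans 2∣r (m∣m*n w))) λ ()
  p⊥w : Coprime p w
  p⊥w = coprime-∣ˡ (m∣m*n r) (coprime-∣ʳ (n∣m*n q) y⊥v)
  q⊥r : Coprime q r
  q⊥r = coprime-∣ˡ (∣n⇒∣m*n 2 (n∣m*n p)) (coprime-∣ʳ (m∣m*n w) 2x⊥u)
  cross : p * p * ((2 * q) * (2 * q) + r * r) ≡ w * w * (q * q + r * r)
  cross = begin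
    p * p * ((2 * q) * (2 * q) + r * r)                 ≡⟨ solve (p ∷ q ∷ r ∷ []) ⟩
    (2 * (p * q)) * (2 * (p * q)) + (p * r) * (p * r)   ≡⟨ squares ⟩
    (r * w) * (r * w) + (q * w) * (q * w)               ≡⟨ solve (q ∷ r ∷ w ∷ []) ⟩
    w * w * (q * q + r * r)                             ∎
    where open ≡-Reasoning

descent-from-even-gap : ∀ {c s t d e} → 0 < s → 0 < d → s * s + d ≡ t * t → Coprime s t →
  (s * t) * (s * t) + d * d ≡ c * c → d ≡ 2 * e → ∃[ c′ ] c′ < c × Solution c′
descent-from-even-gap {c} {s} {t} {d} {e} s>0 d>0 gap s⊥t pyth refl =
  case primitive-pythagorean-triple {s * t} {d} {c} {e} (coprime-square-gap s⊥t gap) pyth refl of λ where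
    (m , n , _ , n²+st≡m² , e≡mn , m⊥n) →
      s * s + e , s²+e<c ,
      solution n m (s * t) (m*n>0⇒n>0 m (subst (0 <_) e≡mn e>0))
        (*-mono-< s>0 (square-gap⇒t>0 {s} {t} d>0 gap)) n²+st≡m² (Coprime.sym m⊥n) (new-pythagorean {m} {n} e≡mn)
  where
  e>0 : 0 < e
  e>0 = m*n>0⇒n>0 2 d>0
  new-pythagorean : ∀ {m n} → e ≡ m * n →
    (n * m) * (n * m) + (s * t) * (s * t) ≡ (s * s + e) * (s * s + e)
  new-pythagorean {m} {n} e≡mn = begin
    (n * m) * (n * m) + (s * t) * (s * t)
      ≡⟨ cong₂ (λ k l → k * k + l) (trans (*-comm n m) (sym e≡mn)) (solve (s ∷ t ∷ [])) ⟩
    e * e + s * s * (t * t)           ≡⟨ cong (λ k → e * e + s * s * k) gap ⟨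
    e * e + s * s * (s * s + 2 * e)   ≡⟨ solve (s ∷ e ∷ []) ⟩
    (s * s + e) * (s * s + e)         ∎
    where open ≡-Reasoning
  s²+e<c : s * s + e < c
  s²+e<c = square-cancel-< (begin-strict
    (s * s + e) * (s * s + e)                     <⟨ m<m+n _ (*-monoʳ-< 3 (*-mono-< e>0 e>0)) ⟩
    (s * s + e) * (s * s + e) + 3 * (e * e)       ≡⟨ solve (s ∷ e ∷ []) ⟩
    s * s * (s * s + 2 * e) + (2 * e) * (2 * e)   ≡⟨ cong (λ k → s * s * k + (2 * e) * (2 * e)) gap ⟩
    s * s * (t * t) + (2 * e) * (2 * e)           ≡⟨ cong (_+ (2 * e) * (2 * e)) (solve (s ∷ t ∷ [])) ⟩
    (s * t) * (s * t) + (2 * e) * (2 * e)         ≡⟨ pyth ⟩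
    c * c                                         ∎)
    where open ≤-Reasoning

descent : ∀ {c} → Solution c → ∃[ c′ ] c′ < c × Solution c′
descent {c} (solution s t d s>0 d>0 gap s⊥t pyth) with parity s in s-parity | parity t in t-parity
... | 1ℙ | 1ℙ = case odd-square-gap-even {s} {t} {d} s-parity t-parity gap of λ where
  (e , d≡2e) → descent-from-even-gap {c} {s} {t} {d} {e} s>0 d>0 gap s⊥t pyth d≡2e
... | 0ℙ | _ with x , refl ← parity≡0ℙ⇒even s s-parity =
  case even-product-triple {2 * x} {t} {d} {c} {x * t} s⊥t gap pyth (*-assoc 2 x t) of λ where
    (m , n , c≡m²+n² , n²+d≡m² , xt≡mn , m⊥n) →
      descent-from-even-leg {c} {x} {t} {m} {n} (m*n>0⇒n>0 2 s>0) (square-gap⇒t>0 {2 * x} {t} d>0 gap)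
        s⊥t m⊥n xt≡mn (common-gap gap n²+d≡m²) c≡m²+n²
... | 1ℙ | 0ℙ with x , refl ← parity≡0ℙ⇒even t t-parity =
  case even-product-triple {s} {2 * x} {d} {c} {s * x} s⊥t gap pyth (x∙yz≈y∙xz s 2 x) of λ where
    (m , n , c≡m²+n² , n²+d≡m² , sx≡mn , m⊥n) →
      descent-from-even-leg {c} {x} {s} {n} {m} (m*n>0⇒n>0 2 (square-gap⇒t>0 {s} {2 * x} d>0 gap)) s>0
        (Coprime.sym s⊥t) (Coprime.sym m⊥n) (trans (*-comm x s) (trans sx≡mn (*-comm m n)))
        (sym (common-gap gap n²+d≡m²)) (trans c≡m²+n² (+-comm (m * m) (n * n)))

no-solution : ∀ c → ¬ Solution c
no-solution = <-rec (λ c → ¬ Solution c) λ _ smaller-impossible sol →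
  let _ , c′<c , sol′ = descent sol in smaller-impossible c′<c sol′

proposition17 : (a b : ℕ) → 0 < a → 0 < b → Coprime a b →
    ¬ (IsSquare (a ^ 2 + b ^ 2 + a * b) × IsSquare (a * (a + b)))
proposition17 a b a>0 b>0 a⊥b ((c , c²≡a²+b²+ab) , (d , d²≡a[a+b]))
  with (s , refl) , (t , t²≡a+b) ←
         coprime-*≡square⇒squares {a} {a + b} {d} (coprime-+ʳ a⊥b) (sym d²≡a[a+b])
  = no-solution c (solution s t b (m*n>0⇒m>0 s a>0) b>0 (sym t²≡a+b) s⊥t pythagorean)
  where
  s⊥t : Coprime s t
  s⊥t = coprime-square⇒coprime (subst (Coprime (s * s)) (sym t²≡a+b) (coprime-+ʳ a⊥b))
  pythagorean : (s * t) * (s * t) + b * b ≡ c * c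
  pythagorean = begin
    (s * t) * (s * t) + b * b                        ≡⟨ cong (_+ b * b) (solve (s ∷ t ∷ [])) ⟩
    s * s * (t * t) + b * b                          ≡⟨ cong (λ k → s * s * k + b * b) t²≡a+b ⟩
    s * s * (s * s + b) + b * b                      ≡⟨ solve (s ∷ b ∷ []) ⟩
    s * s * (s * s * 1) + b * (b * 1) + s * s * b    ≡⟨⟩
    (s * s) ^ 2 + b ^ 2 + s * s * b                  ≡⟨ c²≡a²+b²+ab ⟨
    c * c                                            ∎
    where open ≡-Reasoning
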